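{- Let $G$ be a graph with positive edge weights, $M$ a matching in $G$, and $k\ge 1$ an integer. Then $$\mathrm{gain}(\mathrm{aug}^{ig}(M,k))\ge\frac{1}{2(k+1)}\cdot\mathrm{gain}(\mathrm{aug}(M,k)).$$
   Context: A path is $M$-alternating if it is a simple path or simple cycle whose edges alternate between $M$ and $E\setminus M$. For an $M$-alternating path $p$, $\mathrm{gain}_M(p)=w(p\setminus M)-w(p\cap M)$, where $w$ of an edge set is the sum of its edge weights; the gain of a set of (vertex-disjoint) paths is the sum of their gains. An $M$-alternating path $p$ is $M$-augmenting if $\mathrm{gain}_M(p)>0$ and either $p$ is a simple cycle, or $p$ is a simple path such that whenever $p$ begins or ends with an edge not in $M$, the corresponding endpoint is not covered by $M$. $p$ is $(M,[1,k])$-augmenting if it is $M$-augmenting and $|E(p)\setminus M|\le k$. The gain-index of $p$ is $\gamma_M(p)=\lceil\log_2\mathrm{gain}_M(p)\rceil$. $I(M)$ is the intersection graph whose vertices are the $(M,[1,k])$-augmenting paths, two being adjacent if they share a vertex of $G$. $\mathrm{aug}(M,k)$ denotes a set of vertex-disjoint $(M,[1,k])$-augmenting paths of maximum total gain. $\mathrm{aug}^{ig}(M,k)$ denotes an index-greedy set: a maximal independent set of $I(M)$ obtained by the greedy sequential algorithm that scans the vertices of $I(M)$ in non-increasing gain-index order and adds a path iff it intersects no previously added path.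
   Formalization: The edge weights of the graph $G$ are positive rationals. -}

module Defs where

open import Data.Nat as ℕ using (ℕ; zero; suc; _^_)
open import Data.Nat.Properties using (m^n≢0)
open import Data.Fin using (Fin)
open import Data.Fin.Properties using (_≟_)
open import Data.Bool using (Bool; true; false; if_then_else_; T; not)
open import Data.Integer as ℤ using (ℤ; +_; -[1+_])
open import Data.Rational as ℚ using (ℚ; 0ℚ; _+_; _-_; _/_)
open import Data.Product using (Σ; _×_; _,_; ∃)
open import Data.Sum using (_⊎_)
open import Data.Unit using (⊤)
open import Data.Empty using (⊥)
open import Data.List using (List; []; _∷_; _++_; length; reverse)
open import Data.Bool.ListAction using (any)
open import Data.List.Relation.Unary.All using (All)
open import Data.List.Relation.Unary.AllPairs using (AllPairs)
open import Data.List.Relation.Unary.Linked using (Linked)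
open import Data.List.Relation.Unary.Unique.Propositional using (Unique)
open import Data.List.Membership.Propositional using (_∈_)
import Data.List.Membership.DecPropositional as DecMem
open import Relation.Nullary using (¬_)
open import Relation.Nullary.Decidable using (isYes)
open import Relation.Binary.PropositionalEquality using (_≡_)

record Graph (n : ℕ) : Set where
  field
    adj        : Fin n → Fin n → Bool
    adj-sym    : ∀ u v → adj u v ≡ adj v u
    adj-irrefl : ∀ u → adj u u ≡ false
    w          : Fin n → Fin n → ℚ
    w-sym      : ∀ u v → w u v ≡ w v u
    w-pos      : ∀ u v → T (adj u v) → 0ℚ ℚ.< w u v
open Graph public

record Matching {n : ℕ} (G : Graph n) : Set where
  field
    inM      : Fin n → Fin n → Bool
    inM-sym  : ∀ u v → inM u v ≡ inM v u
    inM⊆adj  : ∀ u v → T (inM u v) → T (adj G u v)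
    inM-uniq : ∀ u v v′ → T (inM u v) → T (inM u v′) → v ≡ v′
open Matching public

module _ {n : ℕ} (G : Graph n) (M : Matching G) where

  V : Set
  V = Fin n

  Path : Set
  Path = List V

  Covered : V → Set
  Covered v = ∃ λ u → T (inM M v u)

  edgesOf : Path → List (V × V)
  edgesOf (u ∷ v ∷ rest) = (u , v) ∷ edgesOf (v ∷ rest)
  edgesOf _ = []

  inMₑ : V × V → Bool
  inMₑ (u , v) = inM M u v

  IsWalk : Path → Set
  IsWalk p = All (λ e → T (adj G (Data.Product.proj₁ e) (Data.Product.proj₂ e))) (edgesOf p)

  SimplePath : Path → Set
  SimplePath p = IsWalk p × Unique p

  SimpleCycle : Path → Set
  SimpleCycle p = IsWalk p × Σ V λ v → Σ (List V) λ q →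
    (p ≡ v ∷ (q ++ v ∷ [])) × Unique (v ∷ q) × (2 ℕ.≤ length q)

  Alt : V × V → V × V → Set
  Alt e f = not (inMₑ e) ≡ inMₑ f

  AltPath : Path → Set
  AltPath p = Linked Alt (edgesOf p)

  CyclicAlt : List (V × V) → Set
  CyclicAlt [] = ⊤
  CyclicAlt (e ∷ es) = Linked Alt ((e ∷ es) ++ e ∷ [])

  gain : Path → ℚ
  gain p = go (edgesOf p)
    where
    go : List (V × V) → ℚ
    go [] = 0ℚ
    go ((u , v) ∷ es) = (if inM M u v then ℚ.- w G u v else w G u v) + go es

  nonMCount : Path → ℕ
  nonMCount p = go (edgesOf p)
    where
    go : List (V × V) → ℕ
    go [] = 0
    go ((u , v) ∷ es) = (if inM M u v then 0 else 1) ℕ.+ go es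

  StartOK : Path → Set
  StartOK (u ∷ v ∷ _) = inM M u v ≡ false → ¬ Covered u
  StartOK _ = ⊤

  EndOK : Path → Set
  EndOK p = StartOK (reverse p)

  Augmenting : Path → Set
  Augmenting p = (0ℚ ℚ.< gain p) ×
    ((SimplePath p × AltPath p × StartOK p × EndOK p)
     ⊎ (SimpleCycle p × CyclicAlt (edgesOf p)))

  KAugmenting : ℕ → Path → Set
  KAugmenting k p = Augmenting p × (nonMCount p ℕ.≤ k)

  Disjoint : Path → Path → Set
  Disjoint p q = ∀ x → x ∈ p → x ∈ q → ⊥

  intersects : Path → Path → Bool
  intersects p q = any (λ x → isYes (x ∈? q)) p
    where open DecMem (_≟_ {n}) using (_∈?_)

  sumGain : List Path → ℚ
  sumGain [] = 0ℚ
  sumGain (p ∷ ps) = gain p + sumGain ps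

  IsAugSet : ℕ → List Path → Set
  IsAugSet k S = All (KAugmenting k) S × AllPairs Disjoint S

  IsMaxAugSet : ℕ → List Path → Set
  IsMaxAugSet k S = IsAugSet k S × (∀ S′ → IsAugSet k S′ → sumGain S′ ℚ.≤ sumGain S)

  pow2 : ℤ → ℚ
  pow2 (+ m) = (+ (2 ^ m)) / 1
  pow2 -[1+ m ] = (+ 1) / (2 ^ suc m)
    where instance _ = m^n≢0 2 (suc m)

  -- γ_M(p) = ⌈log₂ gain_M(p)⌉, i.e. the integer z with 2^(z−1) < gain ≤ 2^z
  IsGainIndex : Path → ℤ → Set
  IsGainIndex p z = (pow2 (z ℤ.- ℤ.1ℤ) ℚ.< gain p) × (gain p ℚ.≤ pow2 z)

  NonIncrGainIndex : List Path → Set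
  NonIncrGainIndex = AllPairs (λ p q → ∀ z z′ → IsGainIndex p z → IsGainIndex q z′ → z′ ℤ.≤ z)

  greedy : List Path → List Path → List Path
  greedy acc [] = acc
  greedy acc (p ∷ ps) =
    if any (intersects p) acc then greedy acc ps else greedy (acc ++ p ∷ []) ps

-- Every augmenting path or cycle q is closed under M: the M-partner of each vertex
-- of q lies on q (alternation, and the free endpoint conditions of paths).  Call
-- the anchors of a path p its first vertex and the vertices entered by an edge of
-- p ∖ M; there are at most k + 1 of them, and every vertex of p is an anchor or the
-- M-partner of one, so a closed q meeting p contains an anchor of p.  When the
-- greedy scan reaches a path q of the optimum, either q is taken or q meets an
-- earlier chosen p; as p has gain-index at least that of q, gain q ≤ 2 · gain p.
-- Charging q to an anchor of p lying on q is injective, since the optimum is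
-- vertex-disjoint, and every greedy path p receives at most (k + 1) · 2 · gain p.

module Submission where

open import Defs
open import Data.Nat as ℕ using (ℕ; suc)
open import Data.Fin using (Fin)
open import Data.Integer using (+_)
open import Data.Rational as ℚ using (_/_; _*_)
open import Data.List using (List; [])
open import Data.List.Relation.Unary.All using (All)
open import Data.List.Membership.Propositional using (_∈_)

open import Algebra.Bundles using (CommutativeMonoid)
open import Data.Bool using (true; false; T; not; if_then_else_)
open import Data.Bool.ListAction using (any)
open import Data.Bool.Properties using (T-≡)
open import Data.Empty using (⊥; ⊥-elim)
open import Data.Integer as ℤ using (-[1+_])
import Data.Integer.Properties as ℤP
import Data.Integer.Tactic.RingSolver as ℤSolver
open import Data.List using (_∷_; _++_; length; map; concatMap; reverse; _∷ʳ_)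
import Data.List.Properties as ListP
open import Data.List.Membership.Propositional using (find)
open import Data.List.Membership.Propositional.Properties
  using (∈-∃++; ∈-++⁺ˡ; ∈-++⁺ʳ; ∈-++⁻; ∈-map⁺; ∈-map⁻; ∈-concatMap⁺; ∈-concatMap⁻)
open import Data.List.Relation.Binary.Permutation.Propositional using (↭-sym)
open import Data.List.Relation.Binary.Permutation.Propositional.Properties using (∈-resp-↭; shift)
open import Data.List.Relation.Binary.Subset.Propositional.Properties using (++⁺; ⊆-refl; xs⊆xs++ys)
open import Data.List.Relation.Unary.All as All using ([]; _∷_)
import Data.List.Relation.Unary.All.Properties as AllP
open import Data.List.Relation.Unary.AllPairs as AllPairs using (AllPairs; _∷_)
open import Data.List.Relation.Unary.Any as Any using (here; there)
open import Data.List.Relation.Unary.Any.Properties using (any⁻)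
open import Data.List.Relation.Unary.Linked using (Linked; _∷_)
open import Data.Nat using (zero; z≤n; s≤s; _^_)
import Data.Nat.Properties as ℕP
import Data.Nat.Tactic.RingSolver as ℕSolver
open import Data.Product using (∃₂; ∃-syntax; _×_; _,_; proj₁; proj₂)
open import Data.Rational using (ℚ; 0ℚ; 1ℚ; _+_; _≤_; _<_; toℚᵘ)
import Data.Rational.Properties as ℚP
open import Data.Rational.Unnormalised as ℚᵘ using (*≡*; *≤*; *<*)
import Data.Rational.Unnormalised.Properties as ℚᵘP
open import Data.Sum as Sum using (_⊎_; inj₁; inj₂)
open import Function using (_∘_)
open import Function.Bundles using (Equivalence)
open import Relation.Binary.PropositionalEquality
open import Relation.Nullary using (¬_; Dec; yes; no)
open import Relation.Nullary.Decidable using (toWitness)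
open import Algebra.Properties.CommutativeSemigroup
  (CommutativeMonoid.commutativeSemigroup ℚP.+-0-commutativeMonoid) using (x∙yz≈y∙xz)

toℚᵘ-/ : ∀ a b .{{_ : ℕ.NonZero b}} → toℚᵘ (+ a / b) ℚᵘ.≃ (+ a) ℚᵘ./ b
toℚᵘ-/ a (suc b) = ℚP.toℚᵘ-fromℚᵘ ((+ a) ℚᵘ./ suc b)

/-≡ : ∀ a b c d .{{_ : ℕ.NonZero b}} .{{_ : ℕ.NonZero d}} →
      a ℕ.* d ≡ c ℕ.* b → + a / b ≡ + c / d
/-≡ a b@(suc _) c d@(suc _) eq = ℚP.toℚᵘ-injective (ℚᵘP.≃-trans (toℚᵘ-/ a b)
  (ℚᵘP.≃-trans (*≡* (subst₂ _≡_ (ℤP.pos-* a d) (ℤP.pos-* c b) (cong +_ eq))) (ℚᵘP.≃-sym (toℚᵘ-/ c d))))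

/-≤ : ∀ a b c d .{{_ : ℕ.NonZero b}} .{{_ : ℕ.NonZero d}} →
      a ℕ.* d ℕ.≤ c ℕ.* b → + a / b ≤ + c / d
/-≤ a b@(suc _) c d@(suc _) le = ℚP.toℚᵘ-cancel-≤
  (ℚᵘP.≤-respˡ-≃ (ℚᵘP.≃-sym (toℚᵘ-/ a b)) (ℚᵘP.≤-respʳ-≃ (ℚᵘP.≃-sym (toℚᵘ-/ c d))
    (*≤* (subst₂ ℤ._≤_ (ℤP.pos-* a d) (ℤP.pos-* c b) (ℤ.+≤+ le)))))

/-< : ∀ a b c d .{{_ : ℕ.NonZero b}} .{{_ : ℕ.NonZero d}} →
      a ℕ.* d ℕ.< c ℕ.* b → + a / b < + c / d
/-< a b@(suc _) c d@(suc _) lt = ℚP.toℚᵘ-cancel-<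
  (ℚᵘP.<-respˡ-≃ (ℚᵘP.≃-sym (toℚᵘ-/ a b)) (ℚᵘP.<-respʳ-≃ (ℚᵘP.≃-sym (toℚᵘ-/ c d))
    (*<* (subst₂ ℤ._<_ (ℤP.pos-* a d) (ℤP.pos-* c b) (ℤ.+<+ lt)))))

/-* : ∀ a b c d .{{_ : ℕ.NonZero b}} .{{_ : ℕ.NonZero d}} →
      (+ a / b) * (+ c / d) ≡ (+ (a ℕ.* c) / (b ℕ.* d)) {{ℕP.m*n≢0 b d}}
/-* a b@(suc _) c d@(suc _) = ℚP.toℚᵘ-injective (ℚᵘP.≃-trans (ℚP.toℚᵘ-homo-* (+ a / b) (+ c / d))
  (ℚᵘP.≃-trans (ℚᵘP.*-cong (toℚᵘ-/ a b) (toℚᵘ-/ c d))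
  (ℚᵘP.≃-trans (ℚᵘP.≃-reflexive (cong (ℚᵘ._/ (b ℕ.* d)) (sym (ℤP.pos-* a c))))
  (ℚᵘP.≃-sym (toℚᵘ-/ (a ℕ.* c) (b ℕ.* d))))))

fromℕ : ℕ → ℚ
fromℕ m = + m / 1

fromℕ-* : ∀ m n → fromℕ (m ℕ.* n) ≡ fromℕ m * fromℕ n
fromℕ-* m n = sym (/-* m 1 n 1)

fromℕ-+ : ∀ m n → fromℕ (m ℕ.+ n) ≡ fromℕ m + fromℕ n
fromℕ-+ m n = ℚP.toℚᵘ-injective (ℚᵘP.≃-trans (toℚᵘ-/ (m ℕ.+ n) 1)
  (ℚᵘP.≃-trans (*≡* eq) (ℚᵘP.≃-sym (ℚᵘP.≃-trans (ℚP.toℚᵘ-homo-+ (fromℕ m) (fromℕ n))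
    (ℚᵘP.+-cong (toℚᵘ-/ m 1) (toℚᵘ-/ n 1))))))
  where
  +-*1 : ∀ x y → (x ℤ.+ y) ℤ.* + 1 ≡ (x ℤ.* + 1 ℤ.+ y ℤ.* + 1) ℤ.* + 1
  +-*1 = ℤSolver.solve-∀
  eq : + (m ℕ.+ n) ℤ.* + 1 ≡ (+ m ℤ.* + 1 ℤ.+ + n ℤ.* + 1) ℤ.* + 1
  eq = trans (cong (ℤ._* + 1) (ℤP.pos-+ m n)) (+-*1 (+ m) (+ n))

fromℕ-mono-≤ : ∀ {m n} → m ℕ.≤ n → fromℕ m ≤ fromℕ n
fromℕ-mono-≤ {m} {n} m≤n = /-≤ m 1 n 1 (ℕP.*-monoˡ-≤ 1 m≤n)

1/n*n≡1 : ∀ m .{{_ : ℕ.NonZero m}} → (+ 1 / m) * fromℕ m ≡ 1ℚ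
1/n*n≡1 m@(suc _) = trans (/-* 1 m m 1) (/-≡ (1 ℕ.* m) (m ℕ.* 1) 1 1 (ℕP.*-assoc 1 m 1))

≤-double : ∀ {x} → 0ℚ ≤ x → x ≤ fromℕ 2 * x
≤-double {x} 0≤x = begin
  x               ≡⟨ sym (ℚP.+-identityʳ x) ⟩
  x + 0ℚ          ≤⟨ ℚP.+-monoʳ-≤ x 0≤x ⟩
  x + x           ≡⟨ cong₂ _+_ (sym (ℚP.*-identityˡ x)) (sym (ℚP.*-identityˡ x)) ⟩
  1ℚ * x + 1ℚ * x ≡⟨ sym (ℚP.*-distribʳ-+ x 1ℚ 1ℚ) ⟩
  fromℕ 2 * x     ∎
  where open ℚP.≤-Reasoning

double-nonNeg : ∀ {x} → 0ℚ ≤ x → 0ℚ ≤ fromℕ 2 * x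
double-nonNeg 0≤x = ℚP.≤-trans 0≤x (≤-double 0≤x)

n<2^n : ∀ m → m ℕ.< 2 ^ m
n<2^n zero = s≤s z≤n
n<2^n (suc m) = ℕP.+-mono-≤-< (ℕP.m^n>0 2 m) (ℕP.<-≤-trans (n<2^n m) (ℕP.m≤m+n (2 ^ m) 0))

ℕ-crossing : ∀ {P : ℕ → Set} → (∀ i → Dec (P i)) → ¬ P 0 → ∀ {j} → P j → ∃[ i ] ¬ P i × P (suc i)
ℕ-crossing P? ¬P0 {zero} P0 = ⊥-elim (¬P0 P0)
ℕ-crossing P? ¬P0 {suc j} Pj+1 with P? j
... | yes Pj = ℕ-crossing P? ¬P0 Pj
... | no ¬Pj = j , ¬Pj , Pj+1

module _ {n : ℕ} (G : Graph n) (M : Matching G) where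

  private
    2^≢0 : ∀ m → ℕ.NonZero (2 ^ m)
    2^≢0 m = ℕP.m^n≢0 2 m

  pow2-mono : ∀ {z′ z} → z′ ℤ.≤ z → pow2 G M z′ ≤ pow2 G M z
  pow2-mono (ℤ.+≤+ {m} {m′} m≤m′) =
    /-≤ (2 ^ m) 1 (2 ^ m′) 1 (ℕP.*-monoˡ-≤ 1 (ℕP.^-monoʳ-≤ 2 m≤m′))
  pow2-mono (ℤ.-≤+ {m} {m′}) =
    /-≤ 1 (2 ^ suc m) (2 ^ m′) 1 {{2^≢0 (suc m)}} (ℕP.*-mono-≤ (ℕP.m^n>0 2 m′) (ℕP.m^n>0 2 (suc m)))
  pow2-mono (ℤ.-≤- {m} {m′} m′≤m) =
    /-≤ 1 (2 ^ suc m) 1 (2 ^ suc m′) {{2^≢0 (suc m)}} {{2^≢0 (suc m′)}}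
        (ℕP.*-monoʳ-≤ 1 (ℕP.^-monoʳ-≤ 2 (s≤s m′≤m)))

  pow2-double : ∀ z → pow2 G M z ≡ fromℕ 2 * pow2 G M (z ℤ.- ℤ.1ℤ)
  pow2-double (+ zero) = refl
  pow2-double (+ suc m) = sym (/-* 2 1 (2 ^ m) 1)
  pow2-double -[1+ m ] = begin
    pow2 G M -[1+ m ]                       ≡⟨ /-≡ 1 2^m+1 2 (1 ℕ.* 2^m+2) (cross 2^m+1) ⟩
    + 2 / (1 ℕ.* 2^m+2)                     ≡⟨ sym (/-* 2 1 1 2^m+2) ⟩
    fromℕ 2 * pow2 G M -[1+ suc m ]         ≡⟨ cong (λ e → fromℕ 2 * pow2 G M -[1+ suc e ]) (sym (ℕP.+-identityʳ m)) ⟩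
    fromℕ 2 * pow2 G M (-[1+ m ] ℤ.- ℤ.1ℤ)  ∎
    where
    open ≡-Reasoning
    2^m+1 = 2 ^ suc m
    2^m+2 = 2 ^ suc (suc m)
    instance
      _ = 2^≢0 (suc m)
      _ = 2^≢0 (suc (suc m))
      _ = ℕP.m*n≢0 1 2^m+2
    cross : ∀ x → 1 ℕ.* (1 ℕ.* (2 ℕ.* x)) ≡ 2 ℕ.* x
    cross = ℕSolver.solve-∀

  bracket-≤-double : ∀ {x y z z′} → pow2 G M (z ℤ.- ℤ.1ℤ) < x → y ≤ pow2 G M z′ → z′ ℤ.≤ z →
                     y ≤ fromℕ 2 * x
  bracket-≤-double {x} {y} {z} {z′} lower upper z′≤z = begin
    y                                 ≤⟨ upper ⟩
    pow2 G M z′                       ≤⟨ pow2-mono z′≤z ⟩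
    pow2 G M z                        ≡⟨ pow2-double z ⟩
    fromℕ 2 * pow2 G M (z ℤ.- ℤ.1ℤ)   ≤⟨ ℚP.*-monoˡ-≤-nonNeg (fromℕ 2) (ℚP.<⇒≤ lower) ⟩
    fromℕ 2 * x                       ∎
    where open ℚP.≤-Reasoning

  -- x = (a+1)/(d+1) lies strictly above 2^-(d+1) and below 2^(a+1); scan the exponents in between.
  log₂-bracket : ∀ x .{{_ : ℚ.Positive x}} → ∃[ z ] pow2 G M (z ℤ.- ℤ.1ℤ) < x × x ≤ pow2 G M z
  log₂-bracket x@(ℚ.mkℚ (+ suc a) d _) =
    bracket (ℕ-crossing (λ j → x ℚP.≤? pow2 G M (base ℤ.+ + j)) ¬below {suc d ℕ.+ suc a} above)
    where
    base = -[1+ d ]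
    P : ℕ → Set
    P j = x ≤ pow2 G M (base ℤ.+ + j)
    x≡ : + suc a / suc d ≡ x
    x≡ = ℚP.↥p/↧p≡p x
    base<x : pow2 G M base < x
    base<x = subst (pow2 G M base <_) x≡ (/-< 1 (2 ^ suc d) (suc a) (suc d) {{2^≢0 (suc d)}}
      (ℕP.<-≤-trans (subst (ℕ._< 2 ^ suc d) (sym (ℕP.*-identityˡ (suc d))) (n<2^n (suc d)))
                    (ℕP.m≤n*m (2 ^ suc d) (suc a))))
    x≤top : x ≤ pow2 G M (+ suc a)
    x≤top = subst (_≤ pow2 G M (+ suc a)) x≡ (/-≤ (suc a) (suc d) (2 ^ suc a) 1
      (ℕP.≤-trans (ℕP.≤-reflexive (ℕP.*-identityʳ (suc a)))
                  (ℕP.≤-trans (ℕP.<⇒≤ (n<2^n (suc a))) (ℕP.m≤m*n (2 ^ suc a) (suc d)))))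
    ¬below : ¬ P 0
    ¬below x≤ = ℚP.<-irrefl refl (ℚP.<-≤-trans base<x (subst (λ v → x ≤ pow2 G M v) (ℤP.+-identityʳ base) x≤))
    above : P (suc d ℕ.+ suc a)
    above = subst (λ v → x ≤ pow2 G M v) (sym (cancel (+ suc d) (+ suc a))) x≤top
      where
      cancel : ∀ u v → ℤ.- u ℤ.+ (u ℤ.+ v) ≡ v
      cancel = ℤSolver.solve-∀
    pred-step : ∀ u v → u ℤ.+ (ℤ.1ℤ ℤ.+ v) ℤ.- ℤ.1ℤ ≡ u ℤ.+ v
    pred-step = ℤSolver.solve-∀
    bracket : ∃[ i ] ¬ P i × P (suc i) → ∃[ z ] pow2 G M (z ℤ.- ℤ.1ℤ) < x × x ≤ pow2 G M z
    bracket (i , ¬Pi , Pi+1) =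
      base ℤ.+ + suc i , subst (_< x) (cong (pow2 G M) (sym (pred-step base (+ i)))) (ℚP.≰⇒> ¬Pi) , Pi+1

  Dominates : List (Fin n) → List (Fin n) → Set
  Dominates p q = 0ℚ < gain G M p → 0ℚ < gain G M q → gain G M q ≤ fromℕ 2 * gain G M p

  sorted⇒Dominates : ∀ {L} → NonIncrGainIndex G M L → AllPairs Dominates L
  sorted⇒Dominates = AllPairs.map λ {p} {q} index≥ p>0 q>0 →
    let z  , p-index = log₂-bracket (gain G M p) {{ℚ.positive p>0}}
        z′ , q-index = log₂-bracket (gain G M q) {{ℚ.positive q>0}}
    in bracket-≤-double (proj₁ p-index) (proj₂ q-index) (index≥ z z′ p-index q-index)

sumℚ : {A : Set} → (A → ℚ) → List A → ℚ
sumℚ f [] = 0ℚ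
sumℚ f (a ∷ as) = f a + sumℚ f as

module _ {A : Set} (f : A → ℚ) where

  sumℚ-++ : ∀ xs ys → sumℚ f (xs ++ ys) ≡ sumℚ f xs + sumℚ f ys
  sumℚ-++ [] ys = sym (ℚP.+-identityˡ (sumℚ f ys))
  sumℚ-++ (x ∷ xs) ys = trans (cong (_+_ (f x)) (sumℚ-++ xs ys)) (sym (ℚP.+-assoc (f x) (sumℚ f xs) (sumℚ f ys)))

  sumℚ-shift : ∀ xs y ys → sumℚ f (xs ++ y ∷ ys) ≡ f y + sumℚ f (xs ++ ys)
  sumℚ-shift [] y ys = refl
  sumℚ-shift (x ∷ xs) y ys = trans (cong (_+_ (f x)) (sumℚ-shift xs y ys)) (x∙yz≈y∙xz (f x) (f y) (sumℚ f (xs ++ ys)))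

  sumℚ-nonNeg : ∀ xs → (∀ {x} → x ∈ xs → 0ℚ ≤ f x) → 0ℚ ≤ sumℚ f xs
  sumℚ-nonNeg [] _ = ℚP.≤-refl
  sumℚ-nonNeg (x ∷ xs) nonNeg =
    ℚP.+-mono-≤ {0ℚ} {f x} {0ℚ} (nonNeg (here refl)) (sumℚ-nonNeg xs (nonNeg ∘ there))

  sumℚ-*ˡ : ∀ c xs → sumℚ (λ x → c * f x) xs ≡ c * sumℚ f xs
  sumℚ-*ˡ c [] = sym (ℚP.*-zeroʳ c)
  sumℚ-*ˡ c (x ∷ xs) = trans (cong (_+_ (c * f x)) (sumℚ-*ˡ c xs)) (sym (ℚP.*-distribˡ-+ c (f x) (sumℚ f xs)))

sumℚ-mono : ∀ {A : Set} {f g : A → ℚ} xs → (∀ {x} → x ∈ xs → f x ≤ g x) → sumℚ f xs ≤ sumℚ g xs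
sumℚ-mono [] _ = ℚP.≤-refl
sumℚ-mono (x ∷ xs) f≤g = ℚP.+-mono-≤ (f≤g (here refl)) (sumℚ-mono xs (f≤g ∘ there))

sumℚ-const : ∀ {A : Set} c (xs : List A) → sumℚ (λ _ → c) xs ≡ fromℕ (length xs) * c
sumℚ-const c [] = sym (ℚP.*-zeroˡ c)
sumℚ-const c (x ∷ xs) = begin
  c + sumℚ (λ _ → c) xs        ≡⟨ cong₂ _+_ (sym (ℚP.*-identityˡ c)) (sumℚ-const c xs) ⟩
  1ℚ * c + fromℕ (length xs) * c ≡⟨ sym (ℚP.*-distribʳ-+ c 1ℚ (fromℕ (length xs))) ⟩
  (1ℚ + fromℕ (length xs)) * c   ≡⟨ cong (_* c) (sym (fromℕ-+ 1 (length xs))) ⟩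
  fromℕ (suc (length xs)) * c    ∎
  where open ≡-Reasoning

sumℚ-concatMap : ∀ {A B : Set} (g : B → ℚ) (h : A → List B) xs →
                 sumℚ g (concatMap h xs) ≡ sumℚ (sumℚ g ∘ h) xs
sumℚ-concatMap g h [] = refl
sumℚ-concatMap g h (x ∷ xs) =
  trans (sumℚ-++ g (h x) (concatMap h xs)) (cong (_+_ (sumℚ g (h x))) (sumℚ-concatMap g h xs))

sumℚ-map : ∀ {A B : Set} (g : B → ℚ) (h : A → B) xs → sumℚ g (map h xs) ≡ sumℚ (g ∘ h) xs
sumℚ-map g h [] = refl
sumℚ-map g h (x ∷ xs) = cong (_+_ (g (h x))) (sumℚ-map g h xs)

sumℚ-≤-charging : ∀ {A B : Set} (f : A → ℚ) (g : B → ℚ) (Charged : A → B → Set) →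
                  (∀ {a b} → Charged a b → f a ≤ g b) →
                  ∀ xs ys → AllPairs (λ a a′ → ∀ {b} → Charged a b → Charged a′ b → ⊥) xs →
                  (∀ {a} → a ∈ xs → ∃[ b ] b ∈ ys × Charged a b) →
                  (∀ {b} → b ∈ ys → 0ℚ ≤ g b) →
                  sumℚ f xs ≤ sumℚ g ys
sumℚ-≤-charging f g Charged f≤g [] ys _ _ nonNeg = sumℚ-nonNeg g ys nonNeg
sumℚ-≤-charging f g Charged f≤g (a ∷ xs) ys (a-alone ∷ xs-apart) charge nonNeg
  with charge (here refl)
... | b , b∈ys , a↦b with ∈-∃++ b∈ys
... | ys₁ , ys₂ , refl = begin
  f a + sumℚ f xs              ≤⟨ ℚP.+-mono-≤ (f≤g a↦b) rest ⟩
  g b + sumℚ g (ys₁ ++ ys₂)     ≡⟨ sym (sumℚ-shift g ys₁ b ys₂) ⟩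
  sumℚ g (ys₁ ++ b ∷ ys₂)       ∎
  where
  open ℚP.≤-Reasoning
  charge′ : ∀ {a′} → a′ ∈ xs → ∃[ b′ ] b′ ∈ ys₁ ++ ys₂ × Charged a′ b′
  charge′ a′∈xs with charge (there a′∈xs)
  ... | b′ , b′∈ys , a′↦b′ with ∈-resp-↭ (shift b ys₁ ys₂) b′∈ys
  ...   | here refl = ⊥-elim (All.lookup a-alone a′∈xs a↦b a′↦b′)
  ...   | there b′∈ys′ = b′ , b′∈ys′ , a′↦b′
  rest : sumℚ f xs ≤ sumℚ g (ys₁ ++ ys₂)
  rest = sumℚ-≤-charging f g Charged f≤g xs (ys₁ ++ ys₂) xs-apart charge′
           (λ b′∈ys′ → nonNeg (∈-resp-↭ (↭-sym (shift b ys₁ ys₂)) (there b′∈ys′)))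

-- Augmenting paths and the greedy scan

module _ {n : ℕ} (G : Graph n) (M : Matching G) where

  private
    T⇒≡ : ∀ {b} → T b → b ≡ true
    T⇒≡ = Equivalence.to T-≡

    ≡⇒T : ∀ {b} → b ≡ true → T b
    ≡⇒T = Equivalence.from T-≡

  matched-unique : ∀ {x y y′} → inM M x y ≡ true → inM M x y′ ≡ true → y ≡ y′
  matched-unique {x} {y} {y′} xy xy′ = inM-uniq M x y y′ (≡⇒T xy) (≡⇒T xy′)

  matched-sym : ∀ {x y b} → inM M x y ≡ b → inM M y x ≡ b
  matched-sym {x} {y} xy = trans (inM-sym M y x) xy

  EndsFreeAt : List (Fin n) → Fin n → Set
  EndsFreeAt (u ∷ v ∷ []) x = x ≡ v × inM M u v ≡ false
  EndsFreeAt (_ ∷ v ∷ w ∷ r) x = EndsFreeAt (v ∷ w ∷ r) x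
  EndsFreeAt _ _ = ⊥

  EndsFreeAt-reverse : ∀ p {x} → EndsFreeAt p x → ∃₂ λ a s → reverse p ≡ x ∷ a ∷ s × inM M a x ≡ false
  EndsFreeAt-reverse (u ∷ v ∷ []) (refl , uv) = u , [] , refl , uv
  EndsFreeAt-reverse (u ∷ v ∷ w ∷ r) free with EndsFreeAt-reverse (v ∷ w ∷ r) free
  ... | a , s , rev , ax = a , s ∷ʳ u , trans (ListP.unfold-reverse u (v ∷ w ∷ r)) (cong (_∷ʳ u) rev) , ax

  EndsFreeAt-++ : ∀ xs {a b x} → EndsFreeAt (xs ++ a ∷ b ∷ []) x → x ≡ b × inM M a b ≡ false
  EndsFreeAt-++ [] free = free
  EndsFreeAt-++ (_ ∷ []) free = free
  EndsFreeAt-++ (_ ∷ _ ∷ []) free = free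
  EndsFreeAt-++ (_ ∷ c ∷ d ∷ xs) free = EndsFreeAt-++ (c ∷ d ∷ xs) free

  alt-partner : ∀ u v r → AltPath G M (u ∷ v ∷ r) → ∀ {x y} → x ∈ v ∷ r → inM M x y ≡ true →
                y ∈ u ∷ v ∷ r ⊎ EndsFreeAt (u ∷ v ∷ r) x
  alt-partner u v r alt (here refl) xy with inM M u v in uv
  ... | true = inj₁ (here (matched-unique xy (matched-sym uv)))
  alt-partner u v [] alt (here refl) xy | false = inj₂ (refl , uv)
  alt-partner u v (w ∷ r) (uv≠vw ∷ _) (here refl) xy | false =
    inj₁ (there (there (here (matched-unique xy (trans (sym uv≠vw) (cong not uv))))))
  alt-partner u v (w ∷ r) (_ ∷ alt) (there x∈) xy = Sum.map₁ there (alt-partner v w r alt x∈ xy)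

  MClosed : List (Fin n) → Set
  MClosed q = ∀ {x y} → x ∈ q → T (inM M x y) → y ∈ q

  path-MClosed : ∀ u v r → AltPath G M (u ∷ v ∷ r) → StartOK G M (u ∷ v ∷ r) → EndOK G M (u ∷ v ∷ r) →
                 MClosed (u ∷ v ∷ r)
  path-MClosed u v r alt start end (here refl) xy with inM M u v in uv
  ... | true = there (here (matched-unique (T⇒≡ xy) uv))
  ... | false = ⊥-elim (start refl (_ , xy))
  path-MClosed u v r alt start end (there x∈) xy with alt-partner u v r alt x∈ (T⇒≡ xy)
  ... | inj₁ y∈ = y∈
  ... | inj₂ free with EndsFreeAt-reverse (u ∷ v ∷ r) free
  ... | a , s , rev , ax = ⊥-elim (subst (StartOK G M) rev end (matched-sym ax) (_ , xy))

  edgesOf-∷ʳ : ∀ c xs a b → edgesOf G M (c ∷ xs ++ a ∷ b ∷ []) ≡ edgesOf G M (c ∷ xs ++ a ∷ []) ++ (a , b) ∷ []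
  edgesOf-∷ʳ c [] a b = refl
  edgesOf-∷ʳ c (d ∷ xs) a b = cong ((c , d) ∷_) (edgesOf-∷ʳ d xs a b)

  -- A cycle is closed by running its alternating walk once more along the first edge,
  -- so that every vertex becomes an inner vertex.
  cycle-MClosed : ∀ v r → 2 ℕ.≤ length r → CyclicAlt G M (edgesOf G M (v ∷ r ++ v ∷ [])) →
                  MClosed (v ∷ r ++ v ∷ [])
  cycle-MClosed v (_ ∷ []) (s≤s ())
  cycle-MClosed v r@(r₀ ∷ r₁ ∷ r′) _ cyc@(first ∷ _) {x} x∈ xy
    with alt-partner v r₀ (r₁ ∷ r′ ++ v ∷ r₀ ∷ []) unrolled (inner x∈) (T⇒≡ xy)
    where
    unrolled : AltPath G M (v ∷ r ++ v ∷ r₀ ∷ [])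
    unrolled = subst (Linked (Alt G M)) (sym (edgesOf-∷ʳ v r v r₀)) cyc
    inner : x ∈ v ∷ r ++ v ∷ [] → x ∈ r ++ v ∷ r₀ ∷ []
    inner (here refl) = ∈-++⁺ʳ r (here refl)
    inner (there x∈) = ++⁺ (⊆-refl {x = r}) (xs⊆xs++ys (v ∷ []) (r₀ ∷ [])) x∈
  ... | inj₁ (here refl) = here refl
  ... | inj₁ (there y∈) with ∈-++⁻ r y∈
  ...   | inj₁ y∈r = there (∈-++⁺ˡ y∈r)
  ...   | inj₂ (here refl) = here refl
  ...   | inj₂ (there (here refl)) = there (here refl)
  cycle-MClosed v (r₀ ∷ r₁ ∷ r′) _ (first ∷ _) x∈ xy | inj₂ free
    with EndsFreeAt-++ (v ∷ r₀ ∷ r₁ ∷ r′) free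
  ... | refl , vr₀ = there (there (here (matched-unique (T⇒≡ xy) (trans (sym first) (cong not vr₀)))))

  augmenting⇒MClosed : ∀ p → Augmenting G M p → MClosed p
  augmenting⇒MClosed _ (_ , inj₂ ((_ , v , r , refl , _ , 2≤|r|) , cyc)) = cycle-MClosed v r 2≤|r| cyc
  augmenting⇒MClosed [] (gain>0 , inj₁ _) = ⊥-elim (ℚP.<-irrefl refl gain>0)
  augmenting⇒MClosed (_ ∷ []) (gain>0 , inj₁ _) = ⊥-elim (ℚP.<-irrefl refl gain>0)
  augmenting⇒MClosed (u ∷ v ∷ r) (_ , inj₁ (_ , alt , start , end)) = path-MClosed u v r alt start end

  freeHeads : List (Fin n) → List (Fin n)
  freeHeads (u ∷ v ∷ r) = if inM M u v then freeHeads (v ∷ r) else v ∷ freeHeads (v ∷ r)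
  freeHeads _ = []

  anchors : List (Fin n) → List (Fin n)
  anchors [] = []
  anchors (u ∷ r) = u ∷ freeHeads (u ∷ r)

  length-freeHeads : ∀ p → length (freeHeads p) ≡ nonMCount G M p
  length-freeHeads [] = refl
  length-freeHeads (_ ∷ []) = refl
  length-freeHeads (u ∷ v ∷ r) with inM M u v | length-freeHeads (v ∷ r)
  ... | true  | ih = ih
  ... | false | ih = cong suc ih

  length-anchors : ∀ p → length (anchors p) ℕ.≤ suc (nonMCount G M p)
  length-anchors [] = z≤n
  length-anchors (u ∷ r) = s≤s (ℕP.≤-reflexive (length-freeHeads (u ∷ r)))

  anchor-meets : ∀ p {q x} → MClosed q → x ∈ p → x ∈ q → ∃[ c ] c ∈ anchors p × c ∈ q
  anchor-meets (u ∷ r) _ (here refl) x∈q = u , here refl , x∈q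
  anchor-meets (u ∷ v ∷ r) closed (there x∈p) x∈q with anchor-meets (v ∷ r) closed x∈p x∈q | inM M u v in uv
  ... | c , here refl , c∈q   | true  = u , here refl , closed c∈q (≡⇒T (matched-sym uv))
  ... | c , here refl , c∈q   | false = c , there (here refl) , c∈q
  ... | c , there c∈ , c∈q    | true  = c , there c∈ , c∈q
  ... | c , there c∈ , c∈q    | false = c , there (there c∈) , c∈q

  Meets : List (Fin n) → List (Fin n) → Set
  Meets p q = ∃[ x ] x ∈ p × x ∈ q

  intersects⇒Meets : ∀ p q → T (intersects G M p q) → Meets p q
  intersects⇒Meets p q p∩q with find (any⁻ _ p p∩q)
  ... | x , x∈p , x∈?q = x , x∈p , toWitness x∈?q

  greedy-⊇ : ∀ acc ps {a} → a ∈ acc → a ∈ greedy G M acc ps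
  greedy-⊇ acc [] a∈ = a∈
  greedy-⊇ acc (p ∷ ps) a∈ with any (intersects G M p) acc
  ... | true  = greedy-⊇ acc ps a∈
  ... | false = greedy-⊇ (acc ++ p ∷ []) ps (∈-++⁺ˡ a∈)

  greedy-All : ∀ {P : List (Fin n) → Set} acc ps → All P acc → All P ps → All P (greedy G M acc ps)
  greedy-All acc [] P-acc _ = P-acc
  greedy-All acc (p ∷ ps) P-acc (Pp ∷ P-ps) with any (intersects G M p) acc
  ... | true  = greedy-All acc ps P-acc P-ps
  ... | false = greedy-All (acc ++ p ∷ []) ps (AllP.++⁺ P-acc (Pp ∷ [])) P-ps

  greedy-dominates : ∀ (R : List (Fin n) → List (Fin n) → Set) acc ps → AllPairs R ps →
                     All (λ a → All (R a) ps) acc →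
                     ∀ {q} → q ∈ ps → ∃[ p ] p ∈ greedy G M acc ps × (p ≡ q ⊎ Meets p q × R p q)
  greedy-dominates R acc (p ∷ ps) (Rp ∷ R-ps) R-acc q∈ with any (intersects G M p) acc in blocked
  greedy-dominates R acc (p ∷ ps) (Rp ∷ R-ps) R-acc (here refl) | true
    with find (any⁻ (intersects G M p) acc (≡⇒T blocked))
  ... | a , a∈acc , p∩a with intersects⇒Meets p a p∩a
  ...   | x , x∈p , x∈a = a , greedy-⊇ acc ps a∈acc , inj₂ ((x , x∈a , x∈p) , All.head (All.lookup R-acc a∈acc))
  greedy-dominates R acc (p ∷ ps) (Rp ∷ R-ps) R-acc (there q∈) | true =
    greedy-dominates R acc ps R-ps (All.map All.tail R-acc) q∈
  greedy-dominates R acc (p ∷ ps) (Rp ∷ R-ps) R-acc (here refl) | false =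
    p , greedy-⊇ (acc ++ p ∷ []) ps (∈-++⁺ʳ acc (here refl)) , inj₁ refl
  greedy-dominates R acc (p ∷ ps) (Rp ∷ R-ps) R-acc (there q∈) | false =
    greedy-dominates R (acc ++ p ∷ []) ps R-ps (AllP.++⁺ (All.map All.tail R-acc) (Rp ∷ [])) q∈

-- Charging the optimum to anchors of greedy paths

module _ {n : ℕ} (G : Graph n) (M : Matching G) (k : ℕ) where

  private
    KAug = KAugmenting G M k
    κ = fromℕ (2 ℕ.* suc k)

  Slot : Set
  Slot = List (Fin n) × Fin n

  slots : List (List (Fin n)) → List Slot
  slots = concatMap (λ p → map (p ,_) (anchors G M p))

  weight : Slot → ℚ
  weight (p , _) = fromℕ 2 * gain G M p

  ∈-slots⁺ : ∀ {p c ps} → p ∈ ps → c ∈ anchors G M p → (p , c) ∈ slots ps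
  ∈-slots⁺ {p} p∈ c∈ = ∈-concatMap⁺ _ (Any.map (λ { refl → ∈-map⁺ (p ,_) c∈ }) p∈)

  ∈-slots⁻ : ∀ {b} ps → b ∈ slots ps → proj₁ b ∈ ps
  ∈-slots⁻ ps b∈ with find (∈-concatMap⁻ _ {xs = ps} b∈)
  ... | p , p∈ , b∈map with ∈-map⁻ (p ,_) b∈map
  ... | c , _ , refl = p∈

  gain-pos : ∀ {p} → KAug p → 0ℚ < gain G M p
  gain-pos ((gain>0 , _) , _) = gain>0

  gain-nonNeg : ∀ {p} → KAug p → 0ℚ ≤ gain G M p
  gain-nonNeg = ℚP.<⇒≤ ∘ gain-pos

  weight-nonNeg : ∀ {p} → KAug p → 0ℚ ≤ fromℕ 2 * gain G M p
  weight-nonNeg = double-nonNeg ∘ gain-nonNeg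

  anchor-sum-≤ : ∀ {p} → KAug p → sumℚ weight (map (p ,_) (anchors G M p)) ≤ κ * gain G M p
  anchor-sum-≤ {p} p-aug@(_ , nonM≤k) = begin
    sumℚ weight (map (p ,_) as)      ≡⟨ sumℚ-map weight (p ,_) as ⟩
    sumℚ (λ _ → fromℕ 2 * g) as      ≡⟨ sumℚ-const (fromℕ 2 * g) as ⟩
    fromℕ (length as) * (fromℕ 2 * g) ≤⟨ ℚP.*-monoʳ-≤-nonNeg (fromℕ 2 * g) {{ℚ.nonNegative (weight-nonNeg p-aug)}}
                                          (fromℕ-mono-≤ (ℕP.≤-trans (length-anchors G M p) (s≤s nonM≤k))) ⟩
    fromℕ (suc k) * (fromℕ 2 * g)    ≡⟨ sym (ℚP.*-assoc (fromℕ (suc k)) (fromℕ 2) g) ⟩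
    fromℕ (suc k) * fromℕ 2 * g      ≡⟨ cong (_* g) (sym (fromℕ-* (suc k) 2)) ⟩
    fromℕ (suc k ℕ.* 2) * g          ≡⟨ cong (λ m → fromℕ m * g) (ℕP.*-comm (suc k) 2) ⟩
    κ * g                            ∎
    where
    open ℚP.≤-Reasoning
    g = gain G M p
    as = anchors G M p

  sumℚ-slots-≤ : ∀ ps → All KAug ps → sumℚ weight (slots ps) ≤ κ * sumℚ (gain G M) ps
  sumℚ-slots-≤ ps ps-aug = begin
    sumℚ weight (slots ps)                                   ≡⟨ sumℚ-concatMap weight _ ps ⟩
    sumℚ (λ p → sumℚ weight (map (p ,_) (anchors G M p))) ps ≤⟨ sumℚ-mono ps (anchor-sum-≤ ∘ All.lookup ps-aug) ⟩
    sumℚ (λ p → κ * gain G M p) ps                           ≡⟨ sumℚ-*ˡ (gain G M) κ ps ⟩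
    κ * sumℚ (gain G M) ps                                   ∎
    where open ℚP.≤-Reasoning

  sumGain≡sumℚ : ∀ ps → sumGain G M ps ≡ sumℚ (gain G M) ps
  sumGain≡sumℚ [] = refl
  sumGain≡sumℚ (p ∷ ps) = cong (_+_ (gain G M p)) (sumGain≡sumℚ ps)

  Charged : List (Fin n) → Slot → Set
  Charged q b = proj₂ b ∈ q × gain G M q ≤ weight b

  first-anchor : ∀ q → 0ℚ < gain G M q → ∃[ c ] c ∈ anchors G M q × c ∈ q
  first-anchor [] gain>0 = ⊥-elim (ℚP.<-irrefl refl gain>0)
  first-anchor (u ∷ _) _ = u , here refl , here refl

  greedy-covers : ∀ {L} → All KAug L → NonIncrGainIndex G M L → ∀ {q} → KAug q → q ∈ L →
                  ∃[ b ] b ∈ slots (greedy G M [] L) × Charged q b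
  greedy-covers {L} L-aug L-sorted {q} q-aug q∈L
    with greedy-dominates G M (Dominates G M) [] L (sorted⇒Dominates G M L-sorted) [] q∈L
  ... | p , p∈Gr , inj₁ refl with first-anchor p (gain-pos q-aug)
  ...   | c , c∈ , c∈q = (p , c) , ∈-slots⁺ p∈Gr c∈ , c∈q , ≤-double (gain-nonNeg q-aug)
  greedy-covers {L} L-aug L-sorted {q} q-aug q∈L
    | p , p∈Gr , inj₂ ((x , x∈p , x∈q) , p≽q)
    with anchor-meets G M p (augmenting⇒MClosed G M q (proj₁ q-aug)) x∈p x∈q
  ...   | c , c∈ , c∈q = (p , c) , ∈-slots⁺ p∈Gr c∈ , c∈q , p≽q (gain-pos p-aug) (gain-pos q-aug)
    where
    p-aug : KAug p
    p-aug = All.lookup (greedy-All G M [] L [] L-aug) p∈Gr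

  greedy-charging : ∀ L → All KAug L → (∀ p → KAug p → p ∈ L) → NonIncrGainIndex G M L →
                    ∀ S → IsAugSet G M k S →
                    sumGain G M S ≤ κ * sumGain G M (greedy G M [] L)
  greedy-charging L L-aug L-complete L-sorted S (S-aug , S-disjoint) = begin
    sumGain G M S           ≡⟨ sumGain≡sumℚ S ⟩
    sumℚ (gain G M) S       ≤⟨ sumℚ-≤-charging (gain G M) weight Charged proj₂ S (slots Gr) apart cover nonNeg ⟩
    sumℚ weight (slots Gr)  ≤⟨ sumℚ-slots-≤ Gr Gr-aug ⟩
    κ * sumℚ (gain G M) Gr  ≡⟨ cong (κ *_) (sym (sumGain≡sumℚ Gr)) ⟩
    κ * sumGain G M Gr      ∎
    where
    open ℚP.≤-Reasoning
    Gr = greedy G M [] L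
    Gr-aug : All KAug Gr
    Gr-aug = greedy-All G M [] L [] L-aug
    apart : AllPairs (λ q q′ → ∀ {b} → Charged q b → Charged q′ b → ⊥) S
    apart = AllPairs.map (λ disjoint {b} c∈q c∈q′ → disjoint (proj₂ b) (proj₁ c∈q) (proj₁ c∈q′)) S-disjoint
    cover : ∀ {q} → q ∈ S → ∃[ b ] b ∈ slots Gr × Charged q b
    cover q∈S = greedy-covers L-aug L-sorted q-aug (L-complete _ q-aug)
      where q-aug = All.lookup S-aug q∈S
    nonNeg : ∀ {b} → b ∈ slots Gr → 0ℚ ≤ weight b
    nonNeg b∈ = weight-nonNeg (All.lookup Gr-aug (∈-slots⁻ Gr b∈))

proposition23 : ∀ {n : ℕ} (G : Graph n) (M : Matching G) (k : ℕ) → 1 ℕ.≤ k →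
    (L : List (List (Fin n))) →
    All (KAugmenting G M k) L →
    (∀ p → KAugmenting G M k p → p ∈ L) →
    NonIncrGainIndex G M L →
    (S : List (List (Fin n))) → IsMaxAugSet G M k S →
    ((+ 1) / (2 ℕ.* suc k)) * sumGain G M S ℚ.≤ sumGain G M (greedy G M [] L)
proposition23 G M k _ L L-aug L-complete L-sorted S (S-aug , _) = begin
  c * sumGain G M S          ≤⟨ ℚP.*-monoˡ-≤-nonNeg c {{ℚP.normalize-nonNeg 1 (2 ℕ.* suc k)}}
                                  (greedy-charging G M k L L-aug L-complete L-sorted S S-aug) ⟩
  c * (κ * sumGain G M Gr)   ≡⟨ sym (ℚP.*-assoc c κ (sumGain G M Gr)) ⟩
  c * κ * sumGain G M Gr     ≡⟨ cong (_* sumGain G M Gr) (1/n*n≡1 (2 ℕ.* suc k)) ⟩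
  1ℚ * sumGain G M Gr        ≡⟨ ℚP.*-identityˡ (sumGain G M Gr) ⟩
  sumGain G M Gr             ∎
  where
  open ℚP.≤-Reasoning
  c = (+ 1) / (2 ℕ.* suc k)
  κ = fromℕ (2 ℕ.* suc k)
  Gr = greedy G M [] L
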